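{- Let $G$ be a finite graph and $v$ a fixed vertex of $G$, of degree $d(v)$. Supplier has an optimal strategy $\mathcal{S}$ for the interactive sum choice game on $G$ with the following two properties. (1) $\mathcal{S}$ always provides the same color $c_1$ at $v$ in response to the first request made at $v$, regardless of what earlier requests have already been made. (2) For any Requester strategy $\mathcal{R}$, if there are $d(v)+1+q$ requests at $v$ in the $(\mathcal{R},\mathcal{S})$-game, where $q\ge0$, then the total number of requests in the $(\mathcal{R},\mathcal{S})$-game is at least $\chi_{\mathrm{ISC}}(G)+q$. Furthermore, all colors supplied at $v$ by $\mathcal{S}$ after the first $d(v)$ colors can be chosen arbitrarily, as long as they have not yet been supplied at $v$.
   Context: Interactive sum choice game on a finite graph $G$: initially every vertex $x$ has an empty list $L(x)$ (colors from a countably infinite set); in each round Requester selects a vertex $x$ (a request at $x$) and Supplier adds to $L(x)$ a color not already in $L(x)$; the game ends as soon as $G$ has a proper coloring $\phi$ with $\phi(x)\in L(x)$ for all $x$; Requester minimizes and Supplier maximizes the number of rounds; $\chi_{\mathrm{ISC}}(G)$ is the number of rounds under optimal play. A Requester strategy chooses the next vertex as a function of the history; a Supplier strategy chooses the supplied color as a function of the history and the requested vertex. An optimal Supplier strategy guarantees at least $\chi_{\mathrm{ISC}}(G)$ rounds against every Requester strategy. For strategies $\mathcal{R},\mathcal{S}$, the $(\mathcal{R},\mathcal{S})$-game is the resulting (determined) sequence of moves. -}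

module Defs where

open import Data.Nat using (ℕ; zero; suc; _+_; _≤_; _<_)
open import Data.Fin using (Fin)
import Data.Fin as Fin
open import Data.Bool using (Bool; true; false; T)
open import Data.List using (List; []; _∷_; length; map; filter; filterᵇ; allFin)
open import Data.List.Membership.Propositional using (_∈_)
open import Data.Product using (Σ; _×_; _,_; proj₁; proj₂; ∃)
open import Relation.Binary.PropositionalEquality using (_≡_; _≢_)
open import Relation.Nullary using (¬_)

record Graph : Set where
  field
    n      : ℕ
    adj    : Fin n → Fin n → Bool
    sym    : ∀ x y → adj x y ≡ adj y x
    irrefl : ∀ x → adj x x ≡ false

open Graph public

Vertex : Graph → Set
Vertex G = Fin (n G)

deg : (G : Graph) → Vertex G → ℕ
deg G v = length (filterᵇ (adj G v) (allFin (n G)))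

Color : Set
Color = ℕ

Move : Graph → Set
Move G = Vertex G × Color

-- A history: the list of moves made so far, most recent move first.
History : Graph → Set
History G = List (Move G)

Lst : (G : Graph) → History G → Vertex G → List Color
Lst G h x = map proj₂ (filter (λ m → proj₁ m Fin.≟ x) h)

Colorable : (G : Graph) → History G → Set
Colorable G h =
  Σ (Vertex G → Color) λ φ →
    (∀ x → φ x ∈ Lst G h x) × (∀ x y → T (adj G x y) → φ x ≢ φ y)

ReqStrategy : Graph → Set
ReqStrategy G = History G → Vertex G

SupStrategy : Graph → Set
SupStrategy G = History G → Vertex G → Color

LegalSup : (G : Graph) → SupStrategy G → Set
LegalSup G S = ∀ h x → ¬ (S h x ∈ Lst G h x)

-- History of the (R,S)-game after k rounds (continued formally past its end).
play : (G : Graph) → ReqStrategy G → SupStrategy G → ℕ → History G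
play G R S zero = []
play G R S (suc k) = (R h , S h (R h)) ∷ h
  where h = play G R S k

EndsAt : (G : Graph) → ReqStrategy G → SupStrategy G → ℕ → Set
EndsAt G R S k =
  Colorable G (play G R S k) × (∀ j → j < k → ¬ Colorable G (play G R S j))

LastsAtLeast : (G : Graph) → ReqStrategy G → SupStrategy G → ℕ → Set
LastsAtLeast G R S m = ∀ j → j < m → ¬ Colorable G (play G R S j)

IsChiISC : Graph → ℕ → Set
IsChiISC G k =
  (Σ (ReqStrategy G) λ R → ∀ S → LegalSup G S →
      Σ ℕ λ j → j ≤ k × Colorable G (play G R S j))
  × (Σ (SupStrategy G) λ S → LegalSup G S × (∀ R → LastsAtLeast G R S k))

OptimalSup : (G : Graph) → ℕ → SupStrategy G → Set
OptimalSup G χ S = LegalSup G S × (∀ R → LastsAtLeast G R S χ)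

module Submission where

-- Fix an optimal Supplier strategy S₀ and let c be its answer to an opening request at v.
-- S answers the first request at v with c, requests at v once v has d = d(v) colors with f,
-- and all other requests as S₀ would on a translated history: the first request at v is
-- moved to the very beginning (where S₀ answers c) and the requests at v beyond the d-th
-- are deleted. A position of the S-game thus yields a position of the S₀-game with the same
-- lists off v, max 1 (min d |L(v)|) colors at v, and one round fewer per deleted request.
-- If |L(v)| = d + 1 + q, at most one further request at v gives v d + 1 colors, more than it
-- has neighbours, so the coloring of G − v extends greedily: the S₀-game has ended after
-- k − q rounds, and optimality of S₀ gives χ ≤ k − q.

open import Defs hiding (sym)
open import Data.Nat using (ℕ; zero; suc; _+_; _∸_; _≤_; _<_; _⊔_; z≤n; s≤s; z<s; _<?_; _≤?_)
open import Data.Nat.Properties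
open import Data.Nat.ListAction using (sum)
import Data.Fin as Fin
open import Data.Bool using (T; T?)
open import Data.List using (List; []; _∷_; [_]; length; map; filterᵇ; allFin; _++_)
open import Data.List.Properties using (length-map; length-++; length-++-sucʳ; ++-assoc)
open import Data.List.Membership.Propositional using (_∈_; _∉_; find)
open import Data.List.Membership.Propositional.Properties
  using (∈-++⁻; ∈-++⁺ˡ; ∈-++⁺ʳ; ∈-∃++; ∈-filter⁺; ∈-allFin; ∈-map⁺)
open import Data.List.Membership.DecPropositional Data.Nat.Properties._≟_ using (_∈?_)
open import Data.List.Relation.Unary.Any using (here; there)
open import Data.List.Relation.Unary.Any.Properties using (¬Any[])
open import Data.List.Relation.Unary.All as All using (All; []; _∷_; all?)
open import Data.List.Relation.Unary.All.Properties using (¬Any⇒All¬; ¬All⇒Any¬)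
open import Data.List.Relation.Unary.Unique.Propositional using (Unique)
open import Data.List.Relation.Unary.AllPairs using ([]; _∷_)
open import Data.Product using (Σ; _×_; _,_; proj₁; proj₂)
open import Data.Sum using (inj₁; inj₂)
open import Data.Empty using (⊥; ⊥-elim)
open import Function using (_∘_)
open import Relation.Binary.PropositionalEquality using (_≡_; _≢_; refl; sym; trans; cong; cong₂; subst; module ≡-Reasoning)
open import Relation.Nullary using (¬_; yes; no)
open import Data.Nat.Solver using (module +-*-Solver)
open +-*-Solver using (solve; _:+_; _:=_)

∈⇒0<length : ∀ {x : ℕ} {L} → x ∈ L → 0 < length L
∈⇒0<length (here _) = z<s
∈⇒0<length (there _) = z<s

0<length⇒≢[] : ∀ {L : List ℕ} → 0 < length L → L ≢ []
0<length⇒≢[] 0<L refl = <-irrefl refl 0<L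

∈⇒≤sum : ∀ {x} {L : List ℕ} → x ∈ L → x ≤ sum L
∈⇒≤sum {L = y ∷ L} (here refl) = m≤m+n y (sum L)
∈⇒≤sum {L = y ∷ L} (there x∈L) = ≤-trans (∈⇒≤sum x∈L) (m≤n+m (sum L) y)

suc-sum∉ : (L : List ℕ) → suc (sum L) ∉ L
suc-sum∉ L p = 1+n≰n (∈⇒≤sum p)

avoid : List ℕ → ℕ → ℕ
avoid L x with x ∈? L
... | yes _ = suc (sum L)
... | no _ = x

avoid-∉ : ∀ L x → avoid L x ∉ L
avoid-∉ L x with x ∈? L
... | yes _ = suc-sum∉ L
... | no x∉L = x∉L

avoid-≡ : ∀ {L x} → x ∉ L → avoid L x ≡ x
avoid-≡ {L} {x} x∉L with x ∈? L
... | yes x∈L = ⊥-elim (x∉L x∈L)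
... | no _ = refl

unique⊆⇒length≤ : ∀ {L N : List ℕ} → Unique L → All (_∈ N) L → length L ≤ length N
unique⊆⇒length≤ [] [] = z≤n
unique⊆⇒length≤ (a∉L ∷ uL) (a∈N ∷ L⊆N) with ∈-∃++ a∈N
... | ys , zs , refl =
  ≤-trans (s≤s (unique⊆⇒length≤ uL (All.zipWith remove (a∉L , L⊆N))))
          (≤-reflexive (sym (length-++-sucʳ ys _ zs)))
  where
  remove : ∀ {b} → _ ≢ b × b ∈ ys ++ _ ∷ zs → b ∈ ys ++ zs
  remove (a≢b , b∈) with ∈-++⁻ ys b∈
  ... | inj₁ b∈ys = ∈-++⁺ˡ b∈ys
  ... | inj₂ (here refl) = ⊥-elim (a≢b refl)
  ... | inj₂ (there b∈zs) = ∈-++⁺ʳ ys b∈zs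

unique-longer⇒∃∉ : ∀ {L N : List ℕ} → Unique L → length N < length L →
                   Σ ℕ λ x → x ∈ L × x ∉ N
unique-longer⇒∃∉ {L} {N} uL N<L with all? (_∈? N) L
... | yes L⊆N = ⊥-elim (<⇒≱ N<L (unique⊆⇒length≤ uL L⊆N))
... | no L⊈N = find (¬All⇒Any¬ (_∈? N) L L⊈N)

+-exchange : ∀ {a b c x y z} → b + x ≡ c + y → a + y ≡ b + z → a + x ≡ c + z
+-exchange {a} {b} {c} {x} {y} {z} e₁ e₂ = +-cancelʳ-≡ (b + y) _ _ (begin
  a + x + (b + y)    ≡⟨ solve 4 (λ a x b y → a :+ x :+ (b :+ y) := (a :+ y) :+ (b :+ x)) refl a x b y ⟩
  (a + y) + (b + x)  ≡⟨ cong₂ _+_ e₂ e₁ ⟩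
  (b + z) + (c + y)  ≡⟨ solve 4 (λ b z c y → (b :+ z) :+ (c :+ y) := c :+ z :+ (b :+ y)) refl b z c y ⟩
  c + z + (b + y)    ∎)
  where open ≡-Reasoning

+-∸-cancel : ∀ {m i k n} → m + i ≡ k + n → n ≤ i → m + (i ∸ n) ≡ k
+-∸-cancel {m} {i} {k} {n} eq n≤i = +-cancelʳ-≡ n _ _ (begin
  m + (i ∸ n) + n    ≡⟨ +-assoc m (i ∸ n) n ⟩
  m + (i ∸ n + n)    ≡⟨ cong (m +_) (m∸n+n≡m n≤i) ⟩
  m + i              ≡⟨ eq ⟩
  k + n              ∎)
  where open ≡-Reasoning

module Histories (G : Graph) where

  Lst-here : ∀ h x col → Lst G ((x , col) ∷ h) x ≡ col ∷ Lst G h x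
  Lst-here h x col with x Fin.≟ x
  ... | yes _ = refl
  ... | no x≢x = ⊥-elim (x≢x refl)

  length-Lst-here : ∀ h x col → length (Lst G ((x , col) ∷ h) x) ≡ suc (length (Lst G h x))
  length-Lst-here h x col = cong length (Lst-here h x col)

  Lst-there : ∀ h {x y} col → x ≢ y → Lst G ((x , col) ∷ h) y ≡ Lst G h y
  Lst-there h {x} {y} col x≢y with x Fin.≟ y
  ... | yes x≡y = ⊥-elim (x≢y x≡y)
  ... | no _ = refl

  Lst-∷-cong : ∀ m {h h′ x} → Lst G h x ≡ Lst G h′ x → Lst G (m ∷ h) x ≡ Lst G (m ∷ h′) x
  Lst-∷-cong (y , col) {x = x} eq with y Fin.≟ x
  ... | yes _ = cong (col ∷_) eq
  ... | no _ = eq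

  data SuppliedBy (S : SupStrategy G) : History G → Set where
    []  : SuppliedBy S []
    _∷_ : ∀ {h x col} → col ≡ S h x → SuppliedBy S h → SuppliedBy S ((x , col) ∷ h)

  play-suppliedBy : ∀ R S k → SuppliedBy S (play G R S k)
  play-suppliedBy R S zero = []
  play-suppliedBy R S (suc k) = refl ∷ play-suppliedBy R S k

  length-play : ∀ R S k → length (play G R S k) ≡ k
  length-play R S zero = refl
  length-play R S (suc k) = cong suc (length-play R S k)

  suppliedBy-unique : ∀ {S h} → LegalSup G S → SuppliedBy S h → ∀ x → Unique (Lst G h x)
  suppliedBy-unique legal [] x = []
  suppliedBy-unique legal (_∷_ {h} {y} refl sh) x with y Fin.≟ x
  ... | yes refl = ¬Any⇒All¬ _ (legal h y) ∷ suppliedBy-unique legal sh x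
  ... | no _ = suppliedBy-unique legal sh x

  -- The vertex requested in round k + 1 of a history (oldest move first), or x₀ beyond it.
  requestAt : Vertex G → History G → ℕ → Vertex G
  requestAt x₀ [] k = x₀
  requestAt x₀ ((x , _) ∷ h) k with length h ≟ k
  ... | yes _ = x
  ... | no _ = requestAt x₀ h k

  requestAt-++ : ∀ x₀ p x col h → requestAt x₀ (p ++ (x , col) ∷ h) (length h) ≡ x
  requestAt-++ x₀ [] x col h with length h ≟ length h
  ... | yes _ = refl
  ... | no h≢h = ⊥-elim (h≢h refl)
  requestAt-++ x₀ (m ∷ p) x col h with length (p ++ (x , col) ∷ h) ≟ length h
  ... | yes eq = ⊥-elim (1+n≰n (begin
        suc (length h)                ≤⟨ m≤n+m _ (length p) ⟩
        length p + suc (length h)     ≡⟨ sym (length-++ p) ⟩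
        length (p ++ (x , col) ∷ h)   ≡⟨ eq ⟩
        length h                      ∎))
    where open ≤-Reasoning
  ... | no _ = requestAt-++ x₀ p x col h

  replay : Vertex G → History G → ReqStrategy G
  replay x₀ u h = requestAt x₀ u (length h)

  replay-play : ∀ {S} x₀ u → SuppliedBy S u → play G (replay x₀ u) S (length u) ≡ u
  replay-play {S} x₀ u su = go [] u su
    where
    go : ∀ p w → SuppliedBy S w → play G (replay x₀ (p ++ w)) S (length w) ≡ w
    go p [] [] = refl
    go p ((x , col) ∷ h) (col≡ ∷ sh)
      rewrite sym (++-assoc p [ (x , col) ] h) | go (p ++ [ (x , col) ]) h sh
            | ++-assoc p [ (x , col) ] h | requestAt-++ x₀ p x col h = cong (λ a → (x , a) ∷ h) (sym col≡)

  lasting⇒≤length : ∀ {S χ u} → (∀ R → LastsAtLeast G R S χ) → Vertex G →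
                    SuppliedBy S u → Colorable G u → χ ≤ length u
  lasting⇒≤length {u = u} lasts x₀ su col = ≮⇒≥ λ u<χ →
    lasts (replay x₀ u) (length u) u<χ (subst (Colorable G) (sym (replay-play x₀ u su)) col)

  -- v has more colors than neighbours, so one of its colors is used by no neighbour.
  extend-coloring : ∀ v H (ψ : Vertex G → Color) →
                    (∀ x → x ≢ v → ψ x ∈ Lst G H x) →
                    (∀ x y → x ≢ v → y ≢ v → T (adj G x y) → ψ x ≢ ψ y) →
                    Unique (Lst G H v) → deg G v < length (Lst G H v) → Colorable G H
  extend-coloring v H ψ ψ∈L ψ-proper uniq deg< = φ , φ∈L , φ-proper
    where
    neighbours = filterᵇ (adj G v) (allFin (n G))

    available : Σ Color λ a → a ∈ Lst G H v × a ∉ map ψ neighbours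
    available = unique-longer⇒∃∉ uniq (subst (_< _) (sym (length-map ψ neighbours)) deg<)

    a = proj₁ available

    φ : Vertex G → Color
    φ y with y Fin.≟ v
    ... | yes _ = a
    ... | no _ = ψ y

    φ∈L : ∀ x → φ x ∈ Lst G H x
    φ∈L x with x Fin.≟ v
    ... | yes refl = proj₁ (proj₂ available)
    ... | no x≢v = ψ∈L x x≢v

    neighbour-color : ∀ y → T (adj G v y) → ψ y ∈ map ψ neighbours
    neighbour-color y vy = ∈-map⁺ ψ (∈-filter⁺ (T? ∘ adj G v) (∈-allFin y) vy)

    a≢neighbour : ∀ y → T (adj G v y) → a ≢ ψ y
    a≢neighbour y vy a≡ψy = proj₂ (proj₂ available) (subst (_∈ _) (sym a≡ψy) (neighbour-color y vy))

    non-loop : ∀ y → T (adj G y y) → ⊥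
    non-loop y yy rewrite irrefl G y = yy

    φ-proper : ∀ x y → T (adj G x y) → φ x ≢ φ y
    φ-proper x y xy with x Fin.≟ v | y Fin.≟ v
    ... | yes refl | yes refl = λ _ → non-loop x xy
    ... | yes refl | no _ = a≢neighbour y xy
    ... | no _ | yes refl = λ ψx≡a → a≢neighbour x (subst T (Graph.sym G x y) xy) (sym ψx≡a)
    ... | no x≢v | no y≢v = ψ-proper x y x≢v y≢v xy

module Construction (G : Graph) (v : Vertex G) (S₀ : SupStrategy G) (f : History G → Color) where
  open Histories G

  d : ℕ
  d = deg G v

  c : Color
  c = S₀ [] v

  data Stage (L : List Color) : Set where
    first     : L ≡ [] → Stage L
    simulated : 0 < length L → length L < d → Stage L
    free      : 0 < length L → d ≤ length L → Stage L

  stage : ∀ L → Stage L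
  stage [] = first refl
  stage (a ∷ L) with suc (length L) <? d
  ... | yes L<d = simulated z<s L<d
  ... | no L≮d = free z<s (≮⇒≥ L≮d)

  translate : History G → History G
  translate [] = (v , c) ∷ []
  translate ((x , col) ∷ h) with x Fin.≟ v | stage (Lst G h v)
  ... | no _ | _ = (x , col) ∷ translate h
  ... | yes _ | simulated _ _ = (x , col) ∷ translate h
  ... | yes _ | _ = translate h

  -- Against S the answer of S₀ is always legal already (the lists agree, see
  -- translate-suppliedBy); avoid only makes S legal on histories S never produces.
  S : SupStrategy G
  S h x with x Fin.≟ v | stage (Lst G h v)
  ... | yes _ | first _ = c
  ... | yes _ | free _ _ = f h
  ... | _ | _ = avoid (Lst G h x) (S₀ (translate h) x)

  S-legal : (∀ h → f h ∉ Lst G h v) → LegalSup G S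
  S-legal f∉ h x with x Fin.≟ v | stage (Lst G h v)
  ... | yes refl | first L≡[] = ¬Any[] ∘ subst (c ∈_) L≡[]
  ... | yes refl | free _ _ = f∉ h
  ... | yes refl | simulated _ _ = avoid-∉ _ _
  ... | no _ | _ = avoid-∉ _ _

  S-first : ∀ h → Lst G h v ≡ [] → S h v ≡ c
  S-first h L≡[] with v Fin.≟ v | stage (Lst G h v)
  ... | no v≢v | _ = ⊥-elim (v≢v refl)
  ... | yes _ | first _ = refl
  ... | yes _ | simulated 0<L _ = ⊥-elim (0<length⇒≢[] 0<L L≡[])
  ... | yes _ | free 0<L _ = ⊥-elim (0<length⇒≢[] 0<L L≡[])

  S-late : ∀ h → d ≤ length (Lst G h v) → 1 ≤ length (Lst G h v) → S h v ≡ f h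
  S-late h d≤L 0<L with v Fin.≟ v | stage (Lst G h v)
  ... | no v≢v | _ = ⊥-elim (v≢v refl)
  ... | yes _ | first L≡[] = ⊥-elim (0<length⇒≢[] 0<L L≡[])
  ... | yes _ | simulated _ L<d = ⊥-elim (<⇒≱ L<d d≤L)
  ... | yes _ | free _ _ = refl

  Lst-translate-≢ : ∀ h {x} → x ≢ v → Lst G (translate h) x ≡ Lst G h x
  Lst-translate-≢ [] x≢v = Lst-there [] c (x≢v ∘ sym)
  Lst-translate-≢ ((y , col) ∷ h) x≢v with y Fin.≟ v | stage (Lst G h v)
  ... | no _ | _ = Lst-∷-cong (y , col) (Lst-translate-≢ h x≢v)
  ... | yes refl | simulated _ _ = Lst-∷-cong (v , col) (Lst-translate-≢ h x≢v)
  ... | yes refl | first _ = trans (Lst-translate-≢ h x≢v) (sym (Lst-there h col (x≢v ∘ sym)))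
  ... | yes refl | free _ _ = trans (Lst-translate-≢ h x≢v) (sym (Lst-there h col (x≢v ∘ sym)))

  Lst-translate-unopened : ∀ h → Lst G h v ≡ [] → Lst G (translate h) v ≡ [ c ]
  Lst-translate-unopened [] _ = Lst-here [] v c
  Lst-translate-unopened ((y , col) ∷ h) L≡[] with y Fin.≟ v | stage (Lst G h v)
  ... | no y≢v | _ = trans (Lst-there (translate h) col y≢v)
                       (Lst-translate-unopened h L≡[])
  ... | yes refl | _ with () ← L≡[]

  Lst-translate-v : ∀ {h} → SuppliedBy S h → 0 < length (Lst G h v) → length (Lst G h v) ≤ d →
                    Lst G (translate h) v ≡ Lst G h v
  Lst-translate-v [] ()
  Lst-translate-v (_∷_ {h} {y} {col} col≡ sh) 0<L L≤d with y Fin.≟ v | stage (Lst G h v)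
  ... | no y≢v | _ = trans (Lst-there (translate h) col y≢v) (Lst-translate-v sh 0<L L≤d)
  ... | yes refl | first L≡[]
    rewrite Lst-translate-unopened h L≡[] | L≡[] | col≡ = refl
  ... | yes refl | simulated 0<L′ L<d =
    trans (Lst-here (translate h) v col) (cong (col ∷_) (Lst-translate-v sh 0<L′ (<⇒≤ L<d)))
  ... | yes refl | free _ d≤L = ⊥-elim (<⇒≱ L≤d d≤L)

  length-Lst-translate-v : ∀ {h} → SuppliedBy S h → d ≤ length (Lst G h v) →
                           length (Lst G (translate h) v) ≡ 1 ⊔ d
  length-Lst-translate-v [] d≤0 rewrite n≤0⇒n≡0 d≤0 = length-Lst-here [] v c
  length-Lst-translate-v (_∷_ {h} {y} {col} col≡ sh) d≤L with y Fin.≟ v | stage (Lst G h v)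
  ... | no y≢v | _ =
    trans (cong length (Lst-there (translate h) col y≢v)) (length-Lst-translate-v sh d≤L)
  ... | yes refl | first L≡[] rewrite Lst-translate-unopened h L≡[] | L≡[] =
    sym (m≥n⇒m⊔n≡m d≤L)
  ... | yes refl | simulated 0<L L<d = begin
    length (Lst G ((v , col) ∷ translate h) v) ≡⟨ length-Lst-here (translate h) v col ⟩
    suc (length (Lst G (translate h) v))       ≡⟨ cong (suc ∘ length) (Lst-translate-v sh 0<L (<⇒≤ L<d)) ⟩
    suc (length (Lst G h v))                   ≡⟨ ≤-antisym L<d d≤L ⟩
    d                                          ≡⟨ sym (m≤n⇒m⊔n≡n (≤-trans (s≤s z≤n) L<d)) ⟩
    1 ⊔ d                                      ∎
    where open ≡-Reasoning
  ... | yes refl | free _ d≤L′ = length-Lst-translate-v sh d≤L′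

  count-translate : ∀ h → length (translate h) + length (Lst G h v) ≡ length h + length (Lst G (translate h) v)
  count-translate [] = sym (length-Lst-here [] v c)
  count-translate ((y , col) ∷ h) with y Fin.≟ v | stage (Lst G h v)
  ... | no y≢v | _ rewrite Lst-there (translate h) col y≢v = cong suc (count-translate h)
  ... | yes refl | first _ = trans (+-suc _ _) (cong suc (count-translate h))
  ... | yes refl | free _ _ = trans (+-suc _ _) (cong suc (count-translate h))
  ... | yes refl | simulated _ _ rewrite Lst-here (translate h) v col =
    cong suc (trans (+-suc _ _) (trans (cong suc (count-translate h)) (sym (+-suc _ _))))

  module _ (legal₀ : LegalSup G S₀) where

    avoid-translate : ∀ h x → Lst G (translate h) x ≡ Lst G h x →
                      avoid (Lst G h x) (S₀ (translate h) x) ≡ S₀ (translate h) x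
    avoid-translate h x same = avoid-≡ (subst (S₀ (translate h) x ∉_) same (legal₀ (translate h) x))

    translate-suppliedBy : ∀ {h} → SuppliedBy S h → SuppliedBy S₀ (translate h)
    translate-suppliedBy [] = refl ∷ []
    translate-suppliedBy (_∷_ {h} {y} {col} col≡ sh) with y Fin.≟ v | stage (Lst G h v)
    ... | no y≢v | _ =
      trans col≡ (avoid-translate h y (Lst-translate-≢ h y≢v)) ∷ translate-suppliedBy sh
    ... | yes refl | simulated 0<L L<d =
      trans col≡ (avoid-translate h v (Lst-translate-v sh 0<L (<⇒≤ L<d))) ∷ translate-suppliedBy sh
    ... | yes refl | first _ = translate-suppliedBy sh
    ... | yes refl | free _ _ = translate-suppliedBy sh

    saturate : ∀ {t} → SuppliedBy S₀ t → length (Lst G t v) ≡ 1 ⊔ d →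
               Σ (History G) λ u → SuppliedBy S₀ u × (∀ x → x ≢ v → Lst G u x ≡ Lst G t x)
                 × length (Lst G u v) ≡ suc d × length u + (1 ⊔ d) ≡ length t + suc d
    saturate {t} st |Lt| with d
    ... | zero = t , st , (λ _ _ → refl) , |Lt| , refl
    ... | suc d′ = (v , S₀ t v) ∷ t , refl ∷ st , (λ x x≢v → Lst-there t _ (x≢v ∘ sym))
                 , trans (length-Lst-here t v _) (cong suc |Lt|) , sym (+-suc (length t) (suc d′))

    Shortcut : History G → Set
    Shortcut h = Σ (History G) λ u → SuppliedBy S₀ u × Colorable G u
                   × length u + (length (Lst G h v) ∸ suc d) ≡ length h

    shortcut-small : ∀ {h} → SuppliedBy S h → Colorable G h → length (Lst G h v) ≤ d → Shortcut h
    shortcut-small {h} sh (φ , φ∈L , φ-proper) L≤d =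
      translate h , translate-suppliedBy sh , (φ , φ∈Lt , φ-proper) , length-eq
      where
      Lt≡L : ∀ x → Lst G (translate h) x ≡ Lst G h x
      Lt≡L x with x Fin.≟ v
      ... | yes refl = Lst-translate-v sh (∈⇒0<length (φ∈L v)) L≤d
      ... | no x≢v = Lst-translate-≢ h x≢v

      φ∈Lt : ∀ x → φ x ∈ Lst G (translate h) x
      φ∈Lt x = subst (φ x ∈_) (sym (Lt≡L x)) (φ∈L x)

      length-eq : length (translate h) + (length (Lst G h v) ∸ suc d) ≡ length h
      length-eq rewrite m≤n⇒m∸n≡0 (m≤n⇒m≤1+n L≤d) | +-identityʳ (length (translate h)) =
        +-cancelʳ-≡ _ _ _ (trans (count-translate h) (cong (λ L → length h + length L) (Lt≡L v)))

    shortcut-large : ∀ {h} → SuppliedBy S h → Colorable G h → d < length (Lst G h v) → Shortcut h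
    shortcut-large {h} sh (φ , φ∈L , φ-proper) d<L
      with |Lt| ← length-Lst-translate-v sh (<⇒≤ d<L)
      with u , su , Lu≡Lt , |Lu| , count-u ← saturate (translate-suppliedBy sh) |Lt|
      = u , su , coloring , +-∸-cancel (+-exchange {length u} {length (translate h)} {length h} count-t count-u) d<L
      where
      count-t : length (translate h) + length (Lst G h v) ≡ length h + (1 ⊔ d)
      count-t = trans (count-translate h) (cong (length h +_) |Lt|)

      φ∈Lu : ∀ x → x ≢ v → φ x ∈ Lst G u x
      φ∈Lu x x≢v = subst (φ x ∈_) (sym (trans (Lu≡Lt x x≢v) (Lst-translate-≢ h x≢v))) (φ∈L x)

      coloring : Colorable G u
      coloring = extend-coloring v u φ φ∈Lu (λ x y _ _ → φ-proper x y)
                   (suppliedBy-unique legal₀ su v) (≤-reflexive (sym |Lu|))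

    shortcut : ∀ {h} → SuppliedBy S h → Colorable G h → Shortcut h
    shortcut {h} sh col with length (Lst G h v) ≤? d
    ... | yes L≤d = shortcut-small sh col L≤d
    ... | no L≰d = shortcut-large sh col (≰⇒> L≰d)

lemma5p6 : (G : Graph) (v : Vertex G) (χ : ℕ) → IsChiISC G χ →
           (f : History G → Color) → (∀ h → ¬ (f h ∈ Lst G h v)) →
           Σ (SupStrategy G) λ S →
             OptimalSup G χ S
             × (Σ Color λ c₁ → ∀ h → Lst G h v ≡ [] → S h v ≡ c₁)
             × (∀ R q k → EndsAt G R S k →
                  length (Lst G (play G R S k) v) ≡ deg G v + 1 + q →
                  χ + q ≤ k)
             × (∀ h → deg G v ≤ length (Lst G h v) → 1 ≤ length (Lst G h v) →
                  S h v ≡ f h)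
lemma5p6 G v χ (_ , S₀ , legal₀ , lasts₀) f f∉ =
  S , (S-legal f∉ , lasting) , (c , S-first) , excess , S-late
  where
  open Histories G
  open Construction G v S₀ f

  χ+excess≤ : ∀ R k → Colorable G (play G R S k) → χ + (length (Lst G (play G R S k) v) ∸ suc d) ≤ k
  χ+excess≤ R k col with u , su , col-u , |u|+excess ← shortcut legal₀ (play-suppliedBy R S k) col =
    subst (χ + excess ≤_) (trans |u|+excess (length-play R S k)) (+-monoˡ-≤ excess (lasting⇒≤length lasts₀ v su col-u))
    where excess = length (Lst G (play G R S k) v) ∸ suc d

  lasting : ∀ R → LastsAtLeast G R S χ
  lasting R j j<χ col = <⇒≱ j<χ (≤-trans (m≤m+n χ _) (χ+excess≤ R j col))

  excess : ∀ R q k → EndsAt G R S k → length (Lst G (play G R S k) v) ≡ d + 1 + q → χ + q ≤ k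
  excess R q k (col , _) L≡ = subst (λ r → χ + r ≤ k) excess≡q (χ+excess≤ R k col)
    where
    excess≡q : length (Lst G (play G R S k) v) ∸ suc d ≡ q
    excess≡q = trans (cong (_∸ suc d) (trans L≡ (cong (_+ q) (+-comm d 1)))) (m+n∸m≡n (suc d) q)
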